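{- There is a deterministic algorithm which, given any integer $k>0$ and any $n$-bit string $F$, produces a summary $S_F$ of $\Theta(k\log^2\frac{n}{k})$ bits, together with a deterministic recovery algorithm which, given $S_F$ and any string $F'$ with $ED(F,F')\le k$, outputs $F$.
   Context: $ED(F,F')$ denotes the edit distance between strings $F$ and $F'$: the minimum number of single-symbol insertions, deletions, or substitutions transforming one into the other. Logarithms are base two. -}

module Defs where

open import Data.Bool using (Bool)
open import Data.List using (List; []; _∷_; _++_)
open import Data.Nat using (ℕ; zero; suc; _+_; _*_; _/_; _≤_)
open import Data.Nat.Logarithm using (⌈log₂_⌉)
open import Data.Product using (Σ; _×_)
open import Relation.Binary.PropositionalEquality using (_≡_)

data Step : List Bool → List Bool → Set where
  ins : ∀ (a b : List Bool) (c : Bool) → Step (a ++ b) (a ++ c ∷ b)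
  del : ∀ (a b : List Bool) (c : Bool) → Step (a ++ c ∷ b) (a ++ b)
  sub : ∀ (a b : List Bool) (c d : Bool) → Step (a ++ c ∷ b) (a ++ d ∷ b)

data Edits : ℕ → List Bool → List Bool → Set where
  done : ∀ {F} → Edits zero F F
  step : ∀ {m F G H} → Step F G → Edits m G H → Edits (suc m) F H

-- ED(F,F') ≤ k : the minimum number of edit operations is at most k,
-- i.e. some sequence of at most k operations transforms F into F'.
EDLe : ℕ → List Bool → List Bool → Set
EDLe k F F' = Σ ℕ λ m → m ≤ k × Edits m F F'

-- L(n,k) = 1 + ⌈log₂ ⌊n/k⌋⌉ (the "+1" keeps the bound meaningful when n/k is small;
-- asymptotically the same as log(n/k)).  Value for k = 0 is irrelevant.
logTerm : ℕ → ℕ → ℕ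
logTerm n zero = 1
logTerm n (suc k) = suc ⌈log₂ (n / suc k) ⌉

bound : ℕ → ℕ → ℕ
bound n k = k * (logTerm n k * logTerm n k)

module Submission where

-- Write K = k > 0 and n = |F|.  The summary is
--     unary K · unary (n mod (2K+1)) · binary colour(F) · zeros,
-- where colour is a greedy proper colouring of the strings of length n in which x and y
-- are adjacent when each is reachable from the other by two rounds of at most K edits.
-- Reachability is made finite and small by edit scripts: an alignment of cost ≤ K is
-- written with O(K log(n/K)) bits (gaps in a unary/binary code with block size
-- 2^⌈log₂(n/K)⌉), so the "script ball" of all strings decoded from L-bit scripts contains
-- every string within K edits and has only 2^L elements, L = O(K log(n/K)).  Hence
-- colours fit into O(K log(n/K)) bits, and the zero padding brings the summary to the
-- prescribed length Θ(K log²(n/K)).  The decoder reads K, searches the ball around F′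
-- for a string with the same summary, and any such string z equals F: z and F lie
-- within 2K edits, so equal residues force equal lengths and the colour separates them.
--
-- Internally the budget is written suc k, so that dividing by it needs no side condition.

open import Defs
import Data.Bool
open import Data.Bool using (Bool; true; false)
open import Data.Empty using (⊥-elim)
open import Data.List using (List; []; _∷_; _++_; length; map; take; drop; replicate; filter; concatMap)
open import Data.List.Properties
  using (∷-injectiveˡ; ∷-injectiveʳ; length-++; length-map; length-replicate; map-++; ++-assoc; take++drop≡id; filter-notAll; ≡-dec)
open import Data.List.Membership.Propositional using (_∈_; _∉_)
open import Data.List.Membership.Propositional.Properties
  using (∈-map⁺; ∈-map⁻; ∈-++⁺ˡ; ∈-++⁺ʳ; ∈-filter⁺; ∈-filter⁻; ∈-concatMap⁺)
open import Data.List.Relation.Unary.Any using (Any; here; there)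
import Data.List.Relation.Unary.Any as Any
open import Data.Maybe using (Maybe; just; nothing)
open import Data.Nat using (ℕ; zero; suc; _≟_; _+_; _*_; _^_; _∸_; _/_; _%_; ⌊_/2⌋; ⌈_/2⌉; _≤_; _<_; z≤n; s≤s; NonZero)
open import Data.List.Membership.DecPropositional _≟_ using (_∈?_)
open import Data.Nat.DivMod using (m≡m%n+[m/n]*n; m%n<n; m/n*n≤m; /-monoˡ-≤; m/n≡1+[m∸n]/n)
open import Data.Nat.Induction using (<-rec)
open import Data.Nat.Logarithm using (⌈log₂_⌉; ⌈log₂⌉-mono-≤; ⌈log₂⌈n/2⌉⌉≡⌈log₂n⌉∸1; ⌈log₂2*n⌉≡1+⌈log₂n⌉)
open import Data.Nat.Properties
open import Data.Nat.Tactic.RingSolver using (solve-∀)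
open import Data.Product using (Σ; _×_; _,_; proj₁; proj₂; map₁; map₂)
open import Function using (_∘_)
open import Relation.Binary.Definitions using (DecidableEquality; tri<; tri≈; tri>)
open import Relation.Binary.PropositionalEquality
open import Relation.Nullary using (¬_; ¬?; yes; no)

data Column : Set where
  match : Bool → Column
  sub   : Bool → Bool → Column
  ins   : Bool → Column
  del   : Bool → Column

top : List Column → List Bool
top [] = []
top (match a ∷ cs) = a ∷ top cs
top (sub a b ∷ cs) = a ∷ top cs
top (ins b ∷ cs) = top cs
top (del a ∷ cs) = a ∷ top cs

bot : List Column → List Bool
bot [] = []
bot (match a ∷ cs) = a ∷ bot cs
bot (sub a b ∷ cs) = b ∷ bot cs
bot (ins b ∷ cs) = b ∷ bot cs
bot (del a ∷ cs) = bot cs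

cost : List Column → ℕ
cost [] = 0
cost (match a ∷ cs) = cost cs
cost (_ ∷ cs) = suc (cost cs)

-- `Alignment m F G`: an alignment of cost at most m with top row F and bottom row G.
-- This is the form of edit distance that can be cut, reversed and encoded column by column.
Alignment : ℕ → List Bool → List Bool → Set
Alignment m F G = Σ (List Column) λ cs → top cs ≡ F × bot cs ≡ G × cost cs ≤ m

top-++ : ∀ cs ds → top (cs ++ ds) ≡ top cs ++ top ds
top-++ [] ds = refl
top-++ (match a ∷ cs) ds = cong (a ∷_) (top-++ cs ds)
top-++ (sub a b ∷ cs) ds = cong (a ∷_) (top-++ cs ds)
top-++ (ins b ∷ cs) ds = top-++ cs ds
top-++ (del a ∷ cs) ds = cong (a ∷_) (top-++ cs ds)

bot-++ : ∀ cs ds → bot (cs ++ ds) ≡ bot cs ++ bot ds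
bot-++ [] ds = refl
bot-++ (match a ∷ cs) ds = cong (a ∷_) (bot-++ cs ds)
bot-++ (sub a b ∷ cs) ds = cong (b ∷_) (bot-++ cs ds)
bot-++ (ins b ∷ cs) ds = cong (b ∷_) (bot-++ cs ds)
bot-++ (del a ∷ cs) ds = bot-++ cs ds

cost-++ : ∀ cs ds → cost (cs ++ ds) ≡ cost cs + cost ds
cost-++ [] ds = refl
cost-++ (match a ∷ cs) ds = cost-++ cs ds
cost-++ (sub a b ∷ cs) ds = cong suc (cost-++ cs ds)
cost-++ (ins b ∷ cs) ds = cong suc (cost-++ cs ds)
cost-++ (del a ∷ cs) ds = cong suc (cost-++ cs ds)

top-matches : ∀ x → top (map match x) ≡ x
top-matches [] = refl
top-matches (a ∷ x) = cong (a ∷_) (top-matches x)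

bot-matches : ∀ x → bot (map match x) ≡ x
bot-matches [] = refl
bot-matches (a ∷ x) = cong (a ∷_) (bot-matches x)

cost-matches : ∀ x → cost (map match x) ≡ 0
cost-matches [] = refl
cost-matches (a ∷ x) = cost-matches x

flip : Column → Column
flip (match a) = match a
flip (sub a b) = sub b a
flip (ins b) = del b
flip (del a) = ins a

top-flip : ∀ cs → top (map flip cs) ≡ bot cs
top-flip [] = refl
top-flip (match a ∷ cs) = cong (a ∷_) (top-flip cs)
top-flip (sub a b ∷ cs) = cong (b ∷_) (top-flip cs)
top-flip (ins b ∷ cs) = cong (b ∷_) (top-flip cs)
top-flip (del a ∷ cs) = top-flip cs

bot-flip : ∀ cs → bot (map flip cs) ≡ top cs
bot-flip [] = refl
bot-flip (match a ∷ cs) = cong (a ∷_) (bot-flip cs)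
bot-flip (sub a b ∷ cs) = cong (a ∷_) (bot-flip cs)
bot-flip (ins b ∷ cs) = bot-flip cs
bot-flip (del a ∷ cs) = cong (a ∷_) (bot-flip cs)

cost-flip : ∀ cs → cost (map flip cs) ≡ cost cs
cost-flip [] = refl
cost-flip (match a ∷ cs) = cost-flip cs
cost-flip (sub a b ∷ cs) = cong suc (cost-flip cs)
cost-flip (ins b ∷ cs) = cong suc (cost-flip cs)
cost-flip (del a ∷ cs) = cong suc (cost-flip cs)

alignment-refl : ∀ F → Alignment 0 F F
alignment-refl F = map match F , top-matches F , bot-matches F , ≤-reflexive (cost-matches F)

alignment-sym : ∀ {m F G} → Alignment m F G → Alignment m G F
alignment-sym (cs , t , b , c) =
  map flip cs , trans (top-flip cs) b , trans (bot-flip cs) t , ≤-trans (≤-reflexive (cost-flip cs)) c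

BottomSplit : List Column → List Bool → List Bool → Set
BottomSplit cs a b = Σ (List Column) λ cs₁ → Σ (List Column) λ cs₂ →
                       cs ≡ cs₁ ++ cs₂ × bot cs₁ ≡ a × bot cs₂ ≡ b

consSplit : ∀ c {cs a b x y} → (∀ ds → bot (c ∷ ds) ≡ y ∷ bot ds) → y ≡ x →
            BottomSplit cs a b → BottomSplit (c ∷ cs) (x ∷ a) b
consSplit c below refl (cs₁ , cs₂ , refl , e₁ , e₂) =
  c ∷ cs₁ , cs₂ , refl , trans (below cs₁) (cong (_ ∷_) e₁) , e₂

splitBottom : ∀ cs a b → bot cs ≡ a ++ b → BottomSplit cs a b
splitBottom cs [] b e = [] , cs , refl , refl , e
splitBottom [] (x ∷ a) b ()
splitBottom (del y ∷ cs) (x ∷ a) b e with splitBottom cs (x ∷ a) b e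
... | cs₁ , cs₂ , refl , e₁ , e₂ = del y ∷ cs₁ , cs₂ , refl , e₁ , e₂
splitBottom (match y ∷ cs) (x ∷ a) b e =
  consSplit (match y) (λ _ → refl) (∷-injectiveˡ e) (splitBottom cs a b (∷-injectiveʳ e))
splitBottom (sub z y ∷ cs) (x ∷ a) b e =
  consSplit (sub z y) (λ _ → refl) (∷-injectiveˡ e) (splitBottom cs a b (∷-injectiveʳ e))
splitBottom (ins y ∷ cs) (x ∷ a) b e =
  consSplit (ins y) (λ _ → refl) (∷-injectiveˡ e) (splitBottom cs a b (∷-injectiveʳ e))

replaceSuffix : ∀ {m T} a b b′ → Alignment m T (a ++ b) →
  (∀ cs → bot cs ≡ b → Σ (List Column) λ cs′ → top cs′ ≡ top cs × bot cs′ ≡ b′ × cost cs′ ≤ suc (cost cs)) →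
  Alignment (suc m) T (a ++ b′)
replaceSuffix {m} a b b′ (cs , t , bt , c) replace with splitBottom cs a b bt
... | cs₁ , cs₂ , refl , e₁ , e₂ with replace cs₂ e₂
... | cs₂′ , t′ , b′-eq , c′ = cs₁ ++ cs₂′ , topEq , botEq , costLe
  where
  open ≤-Reasoning
  topEq : top (cs₁ ++ cs₂′) ≡ _
  topEq = trans (top-++ cs₁ cs₂′) (trans (cong (top cs₁ ++_) t′) (trans (sym (top-++ cs₁ cs₂)) t))
  botEq : bot (cs₁ ++ cs₂′) ≡ a ++ b′
  botEq = trans (bot-++ cs₁ cs₂′) (cong₂ _++_ e₁ b′-eq)
  costLe : cost (cs₁ ++ cs₂′) ≤ suc m
  costLe = begin
    cost (cs₁ ++ cs₂′)          ≡⟨ cost-++ cs₁ cs₂′ ⟩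
    cost cs₁ + cost cs₂′        ≤⟨ +-monoʳ-≤ (cost cs₁) c′ ⟩
    cost cs₁ + suc (cost cs₂)   ≡⟨ +-suc (cost cs₁) (cost cs₂) ⟩
    suc (cost cs₁ + cost cs₂)   ≡⟨ cong suc (sym (cost-++ cs₁ cs₂)) ⟩
    suc (cost (cs₁ ++ cs₂))     ≤⟨ s≤s c ⟩
    suc m                       ∎

push : Maybe Bool → List Bool → List Bool
push nothing b = b
push (just d) b = d ∷ b

retarget : Maybe Bool → List Column → List Column
retarget o [] = []
retarget o (del a ∷ cs) = del a ∷ retarget o cs
retarget nothing (match a ∷ cs) = del a ∷ cs
retarget nothing (sub a b ∷ cs) = del a ∷ cs
retarget nothing (ins b ∷ cs) = cs
retarget (just d) (match a ∷ cs) = sub a d ∷ cs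
retarget (just d) (sub a b ∷ cs) = sub a d ∷ cs
retarget (just d) (ins b ∷ cs) = ins d ∷ cs

retarget-correct : ∀ o cs {c b} → bot cs ≡ c ∷ b →
  top (retarget o cs) ≡ top cs × bot (retarget o cs) ≡ push o b × cost (retarget o cs) ≤ suc (cost cs)
retarget-correct o [] ()
retarget-correct o (del a ∷ cs) e with retarget-correct o cs e
... | t , b , c = cong (a ∷_) t , b , s≤s c
retarget-correct nothing (match a ∷ cs) e = refl , ∷-injectiveʳ e , ≤-refl
retarget-correct nothing (sub a x ∷ cs) e = refl , ∷-injectiveʳ e , n≤1+n _
retarget-correct nothing (ins x ∷ cs) e = refl , ∷-injectiveʳ e , m≤n⇒m≤1+n (n≤1+n _)
retarget-correct (just d) (match a ∷ cs) e = refl , cong (d ∷_) (∷-injectiveʳ e) , ≤-refl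
retarget-correct (just d) (sub a x ∷ cs) e = refl , cong (d ∷_) (∷-injectiveʳ e) , n≤1+n _
retarget-correct (just d) (ins x ∷ cs) e = refl , cong (d ∷_) (∷-injectiveʳ e) , n≤1+n _

extend : ∀ {m T G G′} → Step G G′ → Alignment m T G → Alignment (suc m) T G′
extend (Step.ins a b c) A = replaceSuffix a b (c ∷ b) A λ cs e → ins c ∷ cs , refl , cong (c ∷_) e , ≤-refl
extend (Step.del a b c) A = replaceSuffix a (c ∷ b) b A λ cs e → retarget nothing cs , retarget-correct nothing cs e
extend (Step.sub a b c d) A = replaceSuffix a (c ∷ b) (d ∷ b) A λ cs e → retarget (just d) cs , retarget-correct (just d) cs e

undo : ∀ {F G} → Step F G → Step G F
undo (Step.ins a b c) = Step.del a b c
undo (Step.del a b c) = Step.ins a b c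
undo (Step.sub a b c d) = Step.sub a b d c

-- A sequence of m edits yields an alignment of cost m: extend on the reversed side.
fromEdits : ∀ {m F H} → Edits m F H → Alignment m F H
fromEdits done = alignment-refl _
fromEdits (step s e) = alignment-sym (extend (undo s) (alignment-sym (fromEdits e)))

fromEDLe : ∀ {k F H} → EDLe k F H → Alignment k F H
fromEDLe (m , m≤k , e) with fromEdits e
... | cs , t , b , c = cs , t , b , ≤-trans c m≤k

bot-length : ∀ cs → length (bot cs) ≤ length (top cs) + cost cs
bot-length [] = z≤n
bot-length (match a ∷ cs) = s≤s (bot-length cs)
bot-length (sub a b ∷ cs) = s≤s (≤-trans (bot-length cs) (+-monoʳ-≤ _ (n≤1+n _)))
bot-length (ins b ∷ cs) = ≤-trans (s≤s (bot-length cs)) (≤-reflexive (sym (+-suc _ _)))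
bot-length (del a ∷ cs) = ≤-trans (bot-length cs) (≤-trans (+-monoʳ-≤ _ (n≤1+n _)) (n≤1+n _))

alignment-length : ∀ {m F G} → Alignment m F G → length G ≤ length F + m
alignment-length (cs , refl , refl , c) = ≤-trans (bot-length cs) (+-monoʳ-≤ _ c)

unary : ℕ → List Bool → List Bool
unary zero t = false ∷ t
unary (suc q) t = true ∷ unary q t

readUnary : List Bool → ℕ × List Bool
readUnary [] = 0 , []
readUnary (false ∷ s) = 0 , s
readUnary (true ∷ s) = map₁ suc (readUnary s)

readUnary-unary : ∀ q t → readUnary (unary q t) ≡ (q , t)
readUnary-unary zero t = refl
readUnary-unary (suc q) t = cong (map₁ suc) (readUnary-unary q t)

unary-injective : ∀ p q {s t} → unary p s ≡ unary q t → p ≡ q × s ≡ t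
unary-injective p q {s} {t} e =
  cong proj₁ decoded , cong proj₂ decoded
  where
  decoded : (p , s) ≡ (q , t)
  decoded = trans (sym (readUnary-unary p s)) (trans (cong readUnary e) (readUnary-unary q t))

length-unary : ∀ q t → length (unary q t) ≡ suc (q + length t)
length-unary zero t = refl
length-unary (suc q) t = cong suc (length-unary q t)

bitValue : Bool → ℕ
bitValue false = 0
bitValue true = 1

half : ℕ → Bool × ℕ
half zero = false , 0
half (suc zero) = true , 0
half (suc (suc n)) = map₂ suc (half n)

half-correct : ∀ n → bitValue (proj₁ (half n)) + 2 * proj₂ (half n) ≡ n
half-correct zero = refl
half-correct (suc zero) = refl
half-correct (suc (suc n)) = begin
  bitValue b + 2 * suc h   ≡⟨ cong (bitValue b +_) (*-suc 2 h) ⟩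
  bitValue b + (2 + 2 * h) ≡⟨ +-suc (bitValue b) (suc (2 * h)) ⟩
  suc (bitValue b + suc (2 * h)) ≡⟨ cong suc (+-suc (bitValue b) (2 * h)) ⟩
  suc (suc (bitValue b + 2 * h)) ≡⟨ cong (suc ∘ suc) (half-correct n) ⟩
  suc (suc n) ∎
  where
  open ≡-Reasoning
  b = proj₁ (half n)
  h = proj₂ (half n)

half-< : ∀ w c → c < 2 ^ suc w → proj₂ (half c) < 2 ^ w
half-< w c c< = *-cancelˡ-< 2 (proj₂ (half c)) (2 ^ w)
  (≤-<-trans (m≤n+m (2 * proj₂ (half c)) (bitValue (proj₁ (half c))))
             (subst (_< 2 * 2 ^ w) (sym (half-correct c)) c<))

binary : ℕ → ℕ → List Bool → List Bool
binary zero c t = t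
binary (suc w) c t = proj₁ (half c) ∷ binary w (proj₂ (half c)) t

readBinary : ℕ → List Bool → ℕ × List Bool
readBinary zero s = 0 , s
readBinary (suc w) [] = 0 , []
readBinary (suc w) (b ∷ s) = map₁ (λ v → bitValue b + 2 * v) (readBinary w s)

readBinary-binary : ∀ w c t → c < 2 ^ w → readBinary w (binary w c t) ≡ (c , t)
readBinary-binary zero zero t _ = refl
readBinary-binary zero (suc c) t (s≤s ())
readBinary-binary (suc w) c t c< rewrite readBinary-binary w (proj₂ (half c)) t (half-< w c c<) =
  cong (_, t) (half-correct c)

binary-injective : ∀ w {c c′ t t′} → c < 2 ^ w → c′ < 2 ^ w → binary w c t ≡ binary w c′ t′ → c ≡ c′
binary-injective w {c} {c′} {t} {t′} c< c′< e = cong proj₁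
  (trans (sym (readBinary-binary w c t c<)) (trans (cong (readBinary w) e) (readBinary-binary w c′ t′ c′<)))

length-binary : ∀ w c t → length (binary w c t) ≡ w + length t
length-binary zero c t = refl
length-binary (suc w) c t = cong suc (length-binary w _ t)

allStrings : ℕ → List (List Bool)
allStrings zero = [] ∷ []
allStrings (suc L) = map (true ∷_) (allStrings L) ++ map (false ∷_) (allStrings L)

length-allStrings : ∀ L → length (allStrings L) ≡ 2 ^ L
length-allStrings zero = refl
length-allStrings (suc L) = begin
  length (map (true ∷_) S ++ map (false ∷_) S)        ≡⟨ length-++ (map (true ∷_) S) ⟩
  length (map (true ∷_) S) + length (map (false ∷_) S) ≡⟨ cong₂ _+_ (length-map _ S) (length-map _ S) ⟩
  length S + length S                                  ≡⟨ cong₂ _+_ (length-allStrings L) (length-allStrings L) ⟩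
  2 ^ L + 2 ^ L                                        ≡⟨ cong (2 ^ L +_) (sym (+-identityʳ (2 ^ L))) ⟩
  2 ^ suc L                                            ∎
  where
  open ≡-Reasoning
  S = allStrings L

∈-allStrings : ∀ s → s ∈ allStrings (length s)
∈-allStrings [] = here refl
∈-allStrings (true ∷ s) = ∈-++⁺ˡ (∈-map⁺ (true ∷_) (∈-allStrings s))
∈-allStrings (false ∷ s) = ∈-++⁺ʳ (map (true ∷_) (allStrings (length s))) (∈-map⁺ (false ∷_) (∈-allStrings s))

blocks : ℕ → ℕ → ℕ
blocks w j = _/_ j (2 ^ w) {{m^n≢0 2 w}}

offset : ℕ → ℕ → ℕ
offset w j = _%_ j (2 ^ w) {{m^n≢0 2 w}}

blocks-offset : ∀ w j → blocks w j * 2 ^ w + offset w j ≡ j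
blocks-offset w j =
  trans (+-comm (blocks w j * 2 ^ w) (offset w j)) (sym (m≡m%n+[m/n]*n j (2 ^ w) {{m^n≢0 2 w}}))

offset-< : ∀ w j → offset w j < 2 ^ w
offset-< w j = m%n<n j (2 ^ w) {{m^n≢0 2 w}}

blocks-≤ : ∀ w j → blocks w j * 2 ^ w ≤ j
blocks-≤ w j = m/n*n≤m j (2 ^ w) {{m^n≢0 2 w}}

-- A gap j is written with block size 2^w as unary(blocks) followed by the w-bit offset,
-- so it costs j/2^w + w + 1 bits; j is recovered as blocks · 2^w + offset.
gapCode : ℕ → ℕ → List Bool → List Bool
gapCode w j t = unary (blocks w j) (binary w (offset w j) t)

readGap : ℕ → List Bool → ℕ × List Bool
readGap w s = proj₁ q * 2 ^ w + proj₁ r , proj₂ r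
  where
  q = readUnary s
  r = readBinary w (proj₂ q)

readGap-gapCode : ∀ w j t → readGap w (gapCode w j t) ≡ (j , t)
readGap-gapCode w j t
  rewrite readUnary-unary (blocks w j) (binary w (offset w j) t)
        | readBinary-binary w (offset w j) t (offset-< w j) =
  cong (_, t) (blocks-offset w j)

data Op : Set where
  subOp : Bool → Op
  insOp : Bool → Op
  delOp : Op

opCode : Op → List Bool → List Bool
opCode (subOp b) t = true ∷ false ∷ b ∷ t
opCode (insOp b) t = true ∷ true ∷ b ∷ t
opCode delOp t = false ∷ false ∷ false ∷ t

-- Reading an opcode; unrecognised bits read as a deletion.
readOp : List Bool → Op × List Bool
readOp (true ∷ false ∷ b ∷ s) = subOp b , s
readOp (true ∷ true ∷ b ∷ s) = insOp b , s
readOp s = delOp , drop 3 s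

readOp-opCode : ∀ op t → readOp (opCode op t) ≡ (op , t)
readOp-opCode (subOp b) t = refl
readOp-opCode (insOp b) t = refl
readOp-opCode delOp t = refl

length-opCode : ∀ op t → length (opCode op t) ≡ 3 + length t
length-opCode (subOp b) t = refl
length-opCode (insOp b) t = refl
length-opCode delOp t = refl

applyOp : Op → List Bool → List Column × List Bool
applyOp (insOp b) y = ins b ∷ [] , y
applyOp (subOp b) (a ∷ y) = sub a b ∷ [] , y
applyOp delOp (a ∷ y) = del a ∷ [] , y
applyOp _ [] = [] , []

applyOp-top : ∀ op y → top (proj₁ (applyOp op y)) ++ proj₂ (applyOp op y) ≡ y
applyOp-top (insOp b) y = refl
applyOp-top (subOp b) (a ∷ y) = refl
applyOp-top delOp (a ∷ y) = refl
applyOp-top (subOp b) [] = refl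
applyOp-top delOp [] = refl

applyOp-cost : ∀ op y → cost (proj₁ (applyOp op y)) ≤ 1
applyOp-cost (insOp b) y = ≤-refl
applyOp-cost (subOp b) (a ∷ y) = ≤-refl
applyOp-cost delOp (a ∷ y) = ≤-refl
applyOp-cost (subOp b) [] = z≤n
applyOp-cost delOp [] = z≤n

editCode : ℕ → ℕ → Op → List Bool → List Bool
editCode w j op t = true ∷ gapCode w j (opCode op t)

-- `encodeScript w j cs t` writes the edits of cs relative to its top row, j being the number
-- of matches since the last edit; a zero bit ends the script and t follows.
encodeScript : ℕ → ℕ → List Column → List Bool → List Bool
encodeScript w j [] t = false ∷ t
encodeScript w j (match a ∷ cs) t = encodeScript w (suc j) cs t
encodeScript w j (sub a b ∷ cs) t = editCode w j (subOp b) (encodeScript w 0 cs t)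
encodeScript w j (ins b ∷ cs) t = editCode w j (insOp b) (encodeScript w 0 cs t)
encodeScript w j (del a ∷ cs) t = editCode w j delOp (encodeScript w 0 cs t)

decodeScript : ℕ → ℕ → List Bool → List Bool → List Column
decodeEdit : ℕ → ℕ → List Bool → ℕ × List Bool → List Column

decodeScript (suc f) w x (true ∷ s) = decodeEdit f w x (readGap w s)
decodeScript _ w x _ = map match x

decodeEdit f w x (j , s) = map match (take j x) ++ proj₁ a ++ decodeScript f w (proj₂ a) (proj₂ o)
  where
  o = readOp s
  a = applyOp (proj₁ o) (drop j x)

decodeScript-top : ∀ f w x s → top (decodeScript f w x s) ≡ x
decodeEdit-top : ∀ f w x g → top (decodeEdit f w x g) ≡ x

decodeScript-top (suc f) w x (true ∷ s) = decodeEdit-top f w x (readGap w s)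
decodeScript-top zero w x s = top-matches x
decodeScript-top (suc f) w x [] = top-matches x
decodeScript-top (suc f) w x (false ∷ s) = top-matches x

decodeEdit-top f w x (j , s) = begin
  top (map match (take j x) ++ cs ++ rest)          ≡⟨ top-++ (map match (take j x)) (cs ++ rest) ⟩
  top (map match (take j x)) ++ top (cs ++ rest)    ≡⟨ cong₂ _++_ (top-matches (take j x)) (top-++ cs rest) ⟩
  take j x ++ top cs ++ top rest                    ≡⟨ cong (λ r → take j x ++ top cs ++ r) (decodeScript-top f w y s′) ⟩
  take j x ++ top cs ++ y                           ≡⟨ cong (take j x ++_) (applyOp-top op (drop j x)) ⟩
  take j x ++ drop j x                              ≡⟨ take++drop≡id j x ⟩
  x                                                 ∎
  where
  open ≡-Reasoning
  op = proj₁ (readOp s)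
  s′ = proj₂ (readOp s)
  cs = proj₁ (applyOp op (drop j x))
  y = proj₂ (applyOp op (drop j x))
  rest = decodeScript f w y s′

decodeScript-cost : ∀ f w x s → cost (decodeScript f w x s) ≤ f
decodeEdit-cost : ∀ f w x g → cost (decodeEdit f w x g) ≤ suc f

decodeScript-cost (suc f) w x (true ∷ s) = decodeEdit-cost f w x (readGap w s)
decodeScript-cost zero w x s = ≤-reflexive (cost-matches x)
decodeScript-cost (suc f) w x [] = ≤-trans (≤-reflexive (cost-matches x)) z≤n
decodeScript-cost (suc f) w x (false ∷ s) = ≤-trans (≤-reflexive (cost-matches x)) z≤n

decodeEdit-cost f w x (j , s) = begin
  cost (map match (take j x) ++ cs ++ rest)          ≡⟨ cost-++ (map match (take j x)) (cs ++ rest) ⟩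
  cost (map match (take j x)) + cost (cs ++ rest)    ≡⟨ cong₂ _+_ (cost-matches (take j x)) (cost-++ cs rest) ⟩
  cost cs + cost rest                                ≤⟨ +-mono-≤ (applyOp-cost op (drop j x)) (decodeScript-cost f w y s′) ⟩
  suc f                                              ∎
  where
  open ≤-Reasoning
  op = proj₁ (readOp s)
  s′ = proj₂ (readOp s)
  cs = proj₁ (applyOp op (drop j x))
  y = proj₂ (applyOp op (drop j x))
  rest = decodeScript f w y s′

take-length : ∀ (p y : List Bool) → take (length p) (p ++ y) ≡ p
take-length [] y = refl
take-length (a ∷ p) y = cong (a ∷_) (take-length p y)

drop-length : ∀ (p y : List Bool) → drop (length p) (p ++ y) ≡ y
drop-length [] y = refl
drop-length (a ∷ p) y = drop-length p y

decodeScript-editCode : ∀ f w p y op t →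
  decodeScript (suc f) w (p ++ y) (editCode w (length p) op t)
    ≡ map match p ++ proj₁ (applyOp op y) ++ decodeScript f w (proj₂ (applyOp op y)) t
decodeScript-editCode f w p y op t = begin
  decodeEdit f w (p ++ y) (readGap w (gapCode w (length p) (opCode op t)))
    ≡⟨ cong (decodeEdit f w (p ++ y)) (readGap-gapCode w (length p) (opCode op t)) ⟩
  decodeEdit f w (p ++ y) (length p , opCode op t)
    ≡⟨ afterGap ⟩
  map match p ++ proj₁ (applyOp op y) ++ decodeScript f w (proj₂ (applyOp op y)) t ∎
  where
  open ≡-Reasoning
  afterGap : decodeEdit f w (p ++ y) (length p , opCode op t)
             ≡ map match p ++ proj₁ (applyOp op y) ++ decodeScript f w (proj₂ (applyOp op y)) t
  afterGap rewrite readOp-opCode op t | take-length p y | drop-length p y = refl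

decodeScript-encodeScript : ∀ f w cs p t → cost cs ≤ f →
  decodeScript f w (p ++ top cs) (encodeScript w (length p) cs t) ≡ map match p ++ cs
decodeScript-encodeScript zero w [] p t _ = map-++ match p []
decodeScript-encodeScript (suc f) w [] p t _ = map-++ match p []
decodeScript-encodeScript f w (match a ∷ cs) p t c = begin
  decodeScript f w (p ++ a ∷ top cs) (encodeScript w (suc (length p)) cs t)
    ≡⟨ cong₂ (λ u v → decodeScript f w u (encodeScript w v cs t))
             (sym (++-assoc p (a ∷ []) (top cs))) (sym (length-snoc p a)) ⟩
  decodeScript f w ((p ++ a ∷ []) ++ top cs) (encodeScript w (length (p ++ a ∷ [])) cs t)
    ≡⟨ decodeScript-encodeScript f w cs (p ++ a ∷ []) t c ⟩
  map match (p ++ a ∷ []) ++ cs      ≡⟨ cong (_++ cs) (map-++ match p (a ∷ [])) ⟩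
  (map match p ++ match a ∷ []) ++ cs ≡⟨ ++-assoc (map match p) (match a ∷ []) cs ⟩
  map match p ++ match a ∷ cs        ∎
  where
  open ≡-Reasoning
  length-snoc : ∀ (p : List Bool) a → length (p ++ a ∷ []) ≡ suc (length p)
  length-snoc p a = trans (length-++ p) (+-comm (length p) 1)
decodeScript-encodeScript (suc f) w (sub a b ∷ cs) p t (s≤s c) =
  trans (decodeScript-editCode f w p (a ∷ top cs) (subOp b) (encodeScript w 0 cs t))
        (cong (λ r → map match p ++ sub a b ∷ r) (decodeScript-encodeScript f w cs [] t c))
decodeScript-encodeScript (suc f) w (ins b ∷ cs) p t (s≤s c) =
  trans (decodeScript-editCode f w p (top cs) (insOp b) (encodeScript w 0 cs t))
        (cong (λ r → map match p ++ ins b ∷ r) (decodeScript-encodeScript f w cs [] t c))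
decodeScript-encodeScript (suc f) w (del a ∷ cs) p t (s≤s c) =
  trans (decodeScript-editCode f w p (a ∷ top cs) delOp (encodeScript w 0 cs t))
        (cong (λ r → map match p ++ del a ∷ r) (decodeScript-encodeScript f w cs [] t c))

gapSum : ℕ → ℕ → List Column → ℕ
gapSum w j [] = 0
gapSum w j (match a ∷ cs) = gapSum w (suc j) cs
gapSum w j (_ ∷ cs) = blocks w j + gapSum w 0 cs

length-editCode : ∀ w j op t → length (editCode w j op t) ≡ blocks w j + (w + 5) + length t
length-editCode w j op t
  rewrite length-unary (blocks w j) (binary w (offset w j) (opCode op t))
        | length-binary w (offset w j) (opCode op t) | length-opCode op t =
  arithmetic (blocks w j) w (length t)
  where
  arithmetic : ∀ q w l → suc (suc (q + (w + (3 + l)))) ≡ q + (w + 5) + l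
  arithmetic = solve-∀

length-edit : ∀ w j op c {s g l} → length s ≡ 1 + c * (w + 5) + g + l →
  length (editCode w j op s) ≡ 1 + suc c * (w + 5) + (blocks w j + g) + l
length-edit w j op c {s} {g} {l} e =
  trans (length-editCode w j op s) (trans (cong (blocks w j + (w + 5) +_) e) (arithmetic (blocks w j) w c g l))
  where
  arithmetic : ∀ q w c g l → q + (w + 5) + (1 + c * (w + 5) + g + l) ≡ 1 + suc c * (w + 5) + (q + g) + l
  arithmetic = solve-∀

length-encodeScript : ∀ w j cs t →
  length (encodeScript w j cs t) ≡ 1 + cost cs * (w + 5) + gapSum w j cs + length t
length-encodeScript w j [] t = refl
length-encodeScript w j (match a ∷ cs) t = length-encodeScript w (suc j) cs t
length-encodeScript w j (sub a b ∷ cs) t = length-edit w j (subOp b) (cost cs) (length-encodeScript w 0 cs t)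
length-encodeScript w j (ins b ∷ cs) t = length-edit w j (insOp b) (cost cs) (length-encodeScript w 0 cs t)
length-encodeScript w j (del a ∷ cs) t = length-edit w j delOp (cost cs) (length-encodeScript w 0 cs t)

edit-blocks-bound : ∀ w j cs → gapSum w 0 cs * 2 ^ w ≤ length (top cs) →
                    (blocks w j + gapSum w 0 cs) * 2 ^ w ≤ j + length (top cs)
edit-blocks-bound w j cs rest = ≤-trans (≤-reflexive (*-distribʳ-+ (2 ^ w) (blocks w j) (gapSum w 0 cs)))
                                        (+-mono-≤ (blocks-≤ w j) rest)

gapSum-bound : ∀ w j cs → gapSum w j cs * 2 ^ w ≤ j + length (top cs)
gapSum-bound w j [] = z≤n
gapSum-bound w j (match a ∷ cs) = ≤-trans (gapSum-bound w (suc j) cs) (≤-reflexive (sym (+-suc j _)))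
gapSum-bound w j (sub a b ∷ cs) =
  ≤-trans (edit-blocks-bound w j cs (gapSum-bound w 0 cs)) (+-monoʳ-≤ j (n≤1+n _))
gapSum-bound w j (ins b ∷ cs) = edit-blocks-bound w j cs (gapSum-bound w 0 cs)
gapSum-bound w j (del a ∷ cs) =
  ≤-trans (edit-blocks-bound w j cs (gapSum-bound w 0 cs)) (+-monoʳ-≤ j (n≤1+n _))

≤2^⌈log₂⌉ : ∀ m → m ≤ 2 ^ ⌈log₂ m ⌉
≤2^⌈log₂⌉ = <-rec _ halving
  where
  halving : ∀ m → (∀ {m′} → m′ < m → m′ ≤ 2 ^ ⌈log₂ m′ ⌉) → m ≤ 2 ^ ⌈log₂ m ⌉
  halving zero _ = z≤n
  halving (suc zero) _ = s≤s z≤n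
  halving m@(suc (suc n)) ih = begin
    m                                     ≡⟨ sym (⌊n/2⌋+⌈n/2⌉≡n m) ⟩
    ⌊ m /2⌋ + h                           ≤⟨ +-monoˡ-≤ h (⌊n/2⌋≤⌈n/2⌉ m) ⟩
    h + h                                 ≤⟨ +-mono-≤ (ih (⌈n/2⌉<n n)) (ih (⌈n/2⌉<n n)) ⟩
    2 ^ ⌈log₂ h ⌉ + 2 ^ ⌈log₂ h ⌉         ≡⟨ cong (2 ^ ⌈log₂ h ⌉ +_) (sym (+-identityʳ _)) ⟩
    2 ^ suc ⌈log₂ h ⌉                     ≡⟨ cong (2 ^_) (sym log-m) ⟩
    2 ^ ⌈log₂ m ⌉                         ∎
    where
    open ≤-Reasoning
    h = ⌈ m /2⌉
    log-positive : 1 ≤ ⌈log₂ m ⌉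
    log-positive = ⌈log₂⌉-mono-≤ {2} {m} (s≤s (s≤s z≤n))
    log-m : ⌈log₂ m ⌉ ≡ suc ⌈log₂ h ⌉
    log-m = trans (sym (m+[n∸m]≡n log-positive)) (cong suc (sym (⌈log₂⌈n/2⌉⌉≡⌈log₂n⌉∸1 m)))

width : ℕ → ℕ → ℕ
width n k = ⌈log₂ (n / suc k) ⌉

width-mono : ∀ k {n n′} → n ≤ n′ → width n k ≤ width n′ k
width-mono k n≤n′ = ⌈log₂⌉-mono-≤ (/-monoˡ-≤ (suc k) n≤n′)

-- With block size 2^w ≥ n/K, a string of length n contains at most 2K blocks.
blocks-bound : ∀ k {q n} → q * 2 ^ width n k ≤ n → q ≤ 2 * suc k
blocks-bound k {q} {n} qr≤n = <⇒≤ (*-cancelʳ-< r q (2 * K) (begin-strict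
  q * r            ≤⟨ qr≤n ⟩
  n                ≡⟨ m≡m%n+[m/n]*n n K ⟩
  n % K + d * K    <⟨ +-monoˡ-< (d * K) (m%n<n n K) ⟩
  suc d * K        ≤⟨ *-monoˡ-≤ K (s≤s (≤2^⌈log₂⌉ d)) ⟩
  suc r * K        ≤⟨ *-monoˡ-≤ K (+-monoˡ-≤ r (m^n>0 2 (width n k))) ⟩
  (r + r) * K      ≡⟨ arithmetic r K ⟩
  2 * K * r        ∎))
  where
  open ≤-Reasoning
  K = suc k
  d = n / K
  r = 2 ^ width n k
  arithmetic : ∀ r K → (r + r) * K ≡ 2 * K * r
  arithmetic = solve-∀

scriptBits : ℕ → ℕ → ℕ
scriptBits n k = 1 + suc k * (width n k + 5) + 2 * suc k

scriptBits-mono : ∀ k {n n′} → n ≤ n′ → scriptBits n k ≤ scriptBits n′ k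
scriptBits-mono k n≤n′ =
  +-monoˡ-≤ (2 * suc k) (+-monoʳ-≤ 1 (*-monoʳ-≤ (suc k) (+-monoˡ-≤ 5 (width-mono k n≤n′))))

script-fits : ∀ k cs → cost cs ≤ suc k →
  let w = width (length (top cs)) k in 1 + cost cs * (w + 5) + gapSum w 0 cs ≤ scriptBits (length (top cs)) k
script-fits k cs c = +-mono-≤ (+-monoʳ-≤ 1 (*-monoˡ-≤ _ c))
                              (blocks-bound k (gapSum-bound (width (length (top cs)) k) 0 cs))

ball : ℕ → ℕ → List Bool → List (List Bool)
ball k L x = map (λ s → bot (decodeScript (suc k) (width (length x) k) x s)) (allStrings L)

length-ball : ∀ k L x → length (ball k L x) ≡ 2 ^ L
length-ball k L x = trans (length-map _ (allStrings L)) (length-allStrings L)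

ball-sound : ∀ k L x y → y ∈ ball k L x → Alignment (suc k) x y
ball-sound k L x y y∈ with ∈-map⁻ _ y∈
... | s , _ , refl = decodeScript (suc k) w x s , decodeScript-top (suc k) w x s , refl , decodeScript-cost (suc k) w x s
  where w = width (length x) k

-- ... and, once L ≥ scriptBits, every string within k + 1 edits of x is a member: its
-- script, padded with zeros to length L, decodes to it.
ball-complete : ∀ k L x y → Alignment (suc k) x y → scriptBits (length x) k ≤ L → y ∈ ball k L x
ball-complete k L x y (cs , refl , refl , c) fits =
  subst (_∈ ball k L (top cs)) decoded (∈-map⁺ _ (subst (λ l → s ∈ allStrings l) length-s (∈-allStrings s)))
  where
  w = width (length (top cs)) k
  ℓ = 1 + cost cs * (w + 5) + gapSum w 0 cs
  s = encodeScript w 0 cs (replicate (L ∸ ℓ) false)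
  length-s : length s ≡ L
  length-s = begin
    length s                                   ≡⟨ length-encodeScript w 0 cs _ ⟩
    ℓ + length (replicate (L ∸ ℓ) false)       ≡⟨ cong (ℓ +_) (length-replicate (L ∸ ℓ)) ⟩
    ℓ + (L ∸ ℓ)                                ≡⟨ m+[n∸m]≡n (≤-trans (script-fits k cs c) fits) ⟩
    L                                          ∎
    where open ≡-Reasoning
  decoded : bot (decodeScript (suc k) w (top cs) s) ≡ bot cs
  decoded = cong bot (decodeScript-encodeScript (suc k) w cs [] _ c)

avoid : ∀ n (l : List ℕ) → length l < n → Σ ℕ λ c → c < n × c ∉ l
avoid (suc m) l l<1+m with m ∈? l
... | no m∉l = m , ≤-refl , m∉l
... | yes m∈l with avoid m (filter (λ y → ¬? (y ≟ m)) l) shorter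
  where
  notAll : ∀ {l} → m ∈ l → Any (λ y → ¬ ¬ (y ≡ m)) l
  notAll (here m≡y) = here λ y≢m → y≢m (sym m≡y)
  notAll (there m∈l) = there (notAll m∈l)
  shorter : length (filter (λ y → ¬? (y ≟ m)) l) < m
  shorter = ≤-trans (filter-notAll (λ y → ¬? (y ≟ m)) l (notAll m∈l)) (≤-pred l<1+m)
... | c , c<m , c∉ = c , m<n⇒m<1+n c<m , λ c∈l → c∉ (∈-filter⁺ (λ y → ¬? (y ≟ m)) c∈l (<⇒≢ c<m))

fresh : List ℕ → ℕ
fresh l = proj₁ (avoid (suc (length l)) l ≤-refl)

fresh-∉ : ∀ l → fresh l ∉ l
fresh-∉ l = proj₂ (proj₂ (avoid (suc (length l)) l ≤-refl))

fresh-≤ : ∀ l → fresh l ≤ length l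
fresh-≤ l = ≤-pred (proj₁ (proj₂ (avoid (suc (length l)) l ≤-refl)))

module Colouring {A : Set} (_≟ᴬ_ : DecidableEquality A) (N : A → List A) where

  colour : List A → A → ℕ
  colour [] y = 0
  colour (x ∷ E) y with y ≟ᴬ x
  ... | yes _ = fresh (map (colour E) (N x))
  ... | no _ = colour E y

  colour-≤ : ∀ E x → colour E x ≤ length (N x)
  colour-≤ [] x = z≤n
  colour-≤ (e ∷ E) x with x ≟ᴬ e
  ... | yes refl = ≤-trans (fresh-≤ (map (colour E) (N x))) (≤-reflexive (length-map (colour E) (N x)))
  ... | no _ = colour-≤ E x

  colour-separates : ∀ E {x y} → x ∈ E → y ∈ E → y ∈ N x → x ∈ N y → colour E x ≡ colour E y → x ≡ y
  colour-separates (e ∷ E) {x} {y} x∈ y∈ y∈Nx x∈Ny same with x ≟ᴬ e | y ≟ᴬ e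
  ... | yes refl | yes refl = refl
  ... | yes refl | no _ =
    ⊥-elim (fresh-∉ (map (colour E) (N x)) (subst (_∈ map (colour E) (N x)) (sym same) (∈-map⁺ (colour E) y∈Nx)))
  ... | no _ | yes refl =
    ⊥-elim (fresh-∉ (map (colour E) (N y)) (subst (_∈ map (colour E) (N y)) same (∈-map⁺ (colour E) x∈Ny)))
  ... | no x≢e | no y≢e = colour-separates E (∈-tail x∈ x≢e) (∈-tail y∈ y≢e) y∈Nx x∈Ny same
    where
    ∈-tail : ∀ {z} → z ∈ e ∷ E → z ≢ e → z ∈ E
    ∈-tail (here z≡e) z≢e = ⊥-elim (z≢e z≡e)
    ∈-tail (there z∈E) _ = z∈E

_≟ₛ_ : DecidableEquality (List Bool)
_≟ₛ_ = ≡-dec Data.Bool._≟_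

-- A script budget that covers every string within k + 1 edits of a string of length
-- at most n + k + 1.
scriptWindow : ℕ → ℕ → ℕ
scriptWindow n k = scriptBits (n + suc k) k

neighbourhood : ℕ → List Bool → List (List Bool)
neighbourhood k x = concatMap (ball k L) (ball k L x)
  where L = scriptWindow (length x) k

length-neighbourhood : ∀ k x →
  length (neighbourhood k x) ≡ 2 ^ (scriptWindow (length x) k + scriptWindow (length x) k)
length-neighbourhood k x = begin
  length (concatMap (ball k L) (ball k L x)) ≡⟨ length-concatMap (ball k L x) ⟩
  length (ball k L x) * 2 ^ L               ≡⟨ cong (_* 2 ^ L) (length-ball k L x) ⟩
  2 ^ L * 2 ^ L                             ≡⟨ ^-distribˡ-+-* 2 L L ⟨
  2 ^ (L + L)                               ∎
  where
  open ≡-Reasoning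
  L = scriptWindow (length x) k
  length-concatMap : ∀ ys → length (concatMap (ball k L) ys) ≡ length ys * 2 ^ L
  length-concatMap [] = refl
  length-concatMap (y ∷ ys) = trans (length-++ (ball k L y)) (cong₂ _+_ (length-ball k L y) (length-concatMap ys))

∈-neighbourhood : ∀ k {x y z} → y ∈ ball k (scriptWindow (length x) k) x →
                  z ∈ ball k (scriptWindow (length x) k) y → z ∈ neighbourhood k x
∈-neighbourhood k {x} y∈ z∈ = ∈-concatMap⁺ (ball k (scriptWindow (length x) k)) (Any.map (λ { refl → z∈ }) y∈)

-- Number of bits of the colour field: enough for any colour up to the degree 2^(2L).
colourBits : ℕ → ℕ → ℕ
colourBits n k = suc (scriptWindow n k + scriptWindow n k)

colourOf : ℕ → ℕ → List Bool → ℕ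
colourOf k n = Colouring.colour _≟ₛ_ (neighbourhood k) (allStrings n)

colourOf-< : ∀ k x → colourOf k (length x) x < 2 ^ colourBits (length x) k
colourOf-< k x = begin-strict
  colourOf k (length x) x          ≤⟨ Colouring.colour-≤ _≟ₛ_ (neighbourhood k) (allStrings (length x)) x ⟩
  length (neighbourhood k x)       ≡⟨ length-neighbourhood k x ⟩
  2 ^ M                            <⟨ m<m+n (2 ^ M) (m^n>0 2 M) ⟩
  2 ^ M + 2 ^ M                    ≡⟨ cong (2 ^ M +_) (sym (+-identityʳ (2 ^ M))) ⟩
  2 ^ suc M                        ∎
  where
  open ≤-Reasoning
  M = scriptWindow (length x) k + scriptWindow (length x) k

-- The length of F is recorded modulo 2K + 1, which determines it among the lengths
-- within 2K of it.
modulus : ℕ → ℕ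
modulus k = suc (suc k + suc k)

header : ℕ → List Bool → List Bool → List Bool
header k x t = unary (suc k) (unary (length x % modulus k) (binary (colourBits (length x) k) (colourOf k (length x) x) t))

encode : ℕ → List Bool → List Bool
encode zero F = []
encode (suc k) F = header k F (replicate (bound (length F) (suc k)) false)

firstOr : ∀ {A : Set} → A → List A → A
firstOr d [] = d
firstOr d (z ∷ _) = z

firstOr-∈ : ∀ {A : Set} {d : A} {x xs} → x ∈ xs → firstOr d xs ∈ xs
firstOr-∈ (here _) = here refl
firstOr-∈ (there _) = here refl

candidates : ℕ → List Bool → List Bool → List (List Bool)
candidates k s F′ = filter (λ z → encode (suc k) z ≟ₛ s) (ball k (scriptBits (length F′) k) F′)

decodeWith : ℕ → List Bool → List Bool → List Bool
decodeWith zero s F′ = F′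
decodeWith (suc k) s F′ = firstOr F′ (candidates k s F′)

decode : List Bool → List Bool → List Bool
decode s F′ = decodeWith (proj₁ (readUnary s)) s F′

residue-gap : ∀ m {a b} .{{_ : NonZero m}} → a % m ≡ b % m → a / m < b / m → a + m ≤ b
residue-gap m {a} {b} same-residue quotient< = begin
  a + m                     ≡⟨ cong (_+ m) (m≡m%n+[m/n]*n a m) ⟩
  a % m + a / m * m + m     ≡⟨ +-assoc (a % m) (a / m * m) m ⟩
  a % m + (a / m * m + m)   ≡⟨ cong (a % m +_) (+-comm (a / m * m) m) ⟩
  a % m + suc (a / m) * m   ≤⟨ +-mono-≤ (≤-reflexive same-residue) (*-monoˡ-≤ m quotient<) ⟩
  b % m + b / m * m         ≡⟨ sym (m≡m%n+[m/n]*n b m) ⟩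
  b                         ∎
  where open ≤-Reasoning

residue-close : ∀ m {a b d} .{{_ : NonZero m}} → a % m ≡ b % m → a ≤ b + d → b ≤ a + d → d < m → a ≡ b
residue-close m {a} {b} {d} same-residue a≤ b≤ d<m with <-cmp (a / m) (b / m)
... | tri≈ _ q≡ _ = begin
  a                  ≡⟨ m≡m%n+[m/n]*n a m ⟩
  a % m + a / m * m  ≡⟨ cong₂ _+_ same-residue (cong (_* m) q≡) ⟩
  b % m + b / m * m  ≡⟨ sym (m≡m%n+[m/n]*n b m) ⟩
  b                  ∎
  where open ≡-Reasoning
... | tri< q< _ _ = ⊥-elim (<⇒≱ d<m (+-cancelˡ-≤ a m d (≤-trans (residue-gap m same-residue q<) b≤)))
... | tri> _ _ q> = ⊥-elim (<⇒≱ d<m (+-cancelˡ-≤ b m d (≤-trans (residue-gap m (sym same-residue) q>) a≤)))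

-- The lengths agree by the residue, hence the colour fields are read with the same width,
-- and z, F are mutual neighbours of equal colour.
header-separates : ∀ k {F F′ z} t t′ → Alignment (suc k) F F′ → Alignment (suc k) F′ z →
                   header k z t′ ≡ header k F t → z ≡ F
header-separates k {F} {F′} {z} t t′ F↝F′ F′↝z same-header =
  Colouring.colour-separates _≟ₛ_ (neighbourhood k) (allStrings n) z∈E (∈-allStrings F) F∈N[z] z∈N[F] same-colour
  where
  K = suc k
  n = length F
  F′≤ : length F′ ≤ n + K
  F′≤ = alignment-length F↝F′
  ≤F′ : length F′ ≤ length z + K
  ≤F′ = alignment-length (alignment-sym F′↝z)
  z≤ : length z ≤ n + (K + K)
  z≤ = ≤-trans (alignment-length F′↝z) (≤-trans (+-monoˡ-≤ K F′≤) (≤-reflexive (+-assoc n K K)))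
  ≤z : n ≤ length z + (K + K)
  ≤z = ≤-trans (alignment-length (alignment-sym F↝F′)) (≤-trans (+-monoˡ-≤ K ≤F′) (≤-reflexive (+-assoc (length z) K K)))
  after-k = proj₂ (unary-injective K K same-header)
  same-length : length z ≡ n
  same-length = residue-close (modulus k) (proj₁ (unary-injective (length z % modulus k) (n % modulus k) after-k)) z≤ ≤z ≤-refl
  same-colour-code : ∀ {n′} → n′ ≡ n → ∀ {c′ c} → c′ < 2 ^ colourBits n′ k → c < 2 ^ colourBits n k →
                     binary (colourBits n′ k) c′ t′ ≡ binary (colourBits n k) c t → c′ ≡ c
  same-colour-code refl c′< c< = binary-injective (colourBits n k) c′< c<
  same-colour : colourOf k n z ≡ colourOf k n F
  same-colour = trans (cong (λ l → colourOf k l z) (sym same-length))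
    (same-colour-code same-length (colourOf-< k z) (colourOf-< k F) (proj₂ (unary-injective (length z % modulus k) (n % modulus k) after-k)))
  z∈E : z ∈ allStrings n
  z∈E = subst (λ l → z ∈ allStrings l) same-length (∈-allStrings z)
  z∈N[F] : z ∈ neighbourhood k F
  z∈N[F] = ∈-neighbourhood k (ball-complete k (scriptWindow n k) F F′ F↝F′ (scriptBits-mono k (m≤m+n n K)))
                             (ball-complete k (scriptWindow n k) F′ z F′↝z (scriptBits-mono k F′≤))
  F∈N[z] : F ∈ neighbourhood k z
  F∈N[z] = ∈-neighbourhood k (ball-complete k (scriptWindow (length z) k) z F′ (alignment-sym F′↝z) (scriptBits-mono k (m≤m+n (length z) K)))
                             (ball-complete k (scriptWindow (length z) k) F′ F (alignment-sym F↝F′) (scriptBits-mono k ≤F′))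

-- Recovery: F itself is a candidate, so the decoder returns a candidate z, which by
-- header-separates equals F.
decode-encode : ∀ k {F F′} → Alignment (suc k) F F′ → decode (encode (suc k) F) F′ ≡ F
decode-encode k {F} {F′} F↝F′ =
  trans (cong (λ j → decodeWith j s F′) reads-k)
        (header-separates k _ _ F↝F′ (ball-sound k (scriptBits (length F′) k) F′ z (proj₁ found)) (proj₂ found))
  where
  s = encode (suc k) F
  reads-k : proj₁ (readUnary s) ≡ suc k
  reads-k = cong proj₁ (readUnary-unary (suc k) _)
  z = firstOr F′ (candidates k s F′)
  F∈ : F ∈ candidates k s F′
  F∈ = ∈-filter⁺ (λ y → encode (suc k) y ≟ₛ s) (ball-complete k (scriptBits (length F′) k) F′ F (alignment-sym F↝F′) ≤-refl) refl
  found : z ∈ ball k (scriptBits (length F′) k) F′ × encode (suc k) z ≡ s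
  found = ∈-filter⁻ (λ y → encode (suc k) y ≟ₛ s) {xs = ball k (scriptBits (length F′) k) F′} (firstOr-∈ F∈)

⌈log₂suc⌉≤ : ∀ d → ⌈log₂ (suc d) ⌉ ≤ suc ⌈log₂ d ⌉
⌈log₂suc⌉≤ zero = z≤n
⌈log₂suc⌉≤ (suc d) = begin
  ⌈log₂ (suc (suc d)) ⌉   ≤⟨ ⌈log₂⌉-mono-≤ (≤-trans (+-monoˡ-≤ (suc d) (s≤s z≤n)) (≤-reflexive (cong (suc d +_) (sym (+-identityʳ (suc d)))))) ⟩
  ⌈log₂ (2 * suc d) ⌉     ≡⟨ ⌈log₂2*n⌉≡1+⌈log₂n⌉ (suc d) ⟩
  suc ⌈log₂ (suc d) ⌉     ∎
  where open ≤-Reasoning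

width-shift : ∀ n k → width (n + suc k) k ≤ suc (width n k)
width-shift n k = ≤-trans (≤-reflexive (cong ⌈log₂_⌉ shifted)) (⌈log₂suc⌉≤ (n / suc k))
  where
  shifted : (n + suc k) / suc k ≡ suc (n / suc k)
  shifted = trans (m/n≡1+[m∸n]/n (m≤n+m (suc k) n)) (cong (λ m → suc (m / suc k)) (m+n∸n≡m n (suc k)))

length-encode : ∀ k F → let n = length F in
  length (encode (suc k) F) ≡ suc (suc k + suc (n % modulus k + colourBits n k)) + bound n (suc k)
length-encode k F = begin
  length (unary K (unary r (binary W c pad)))   ≡⟨ length-unary K _ ⟩
  suc (K + length (unary r (binary W c pad)))   ≡⟨ cong (λ l → suc (K + l)) (length-unary r _) ⟩
  suc (K + suc (r + length (binary W c pad)))   ≡⟨ cong (λ l → suc (K + suc (r + l))) (length-binary W c pad) ⟩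
  suc (K + suc (r + (W + length pad)))          ≡⟨ cong (λ l → suc (K + suc (r + (W + l)))) (length-replicate b) ⟩
  suc (K + suc (r + (W + b)))                   ≡⟨ arithmetic K r W b ⟩
  suc (K + suc (r + W)) + b                     ∎
  where
  open ≡-Reasoning
  K = suc k
  n = length F
  r = n % modulus k
  W = colourBits n k
  c = colourOf k n F
  b = bound n K
  pad = replicate b false
  arithmetic : ∀ K r W b → suc (K + suc (r + (W + b))) ≡ suc (K + suc (r + W)) + b
  arithmetic = solve-∀

encode-lower : ∀ k F → bound (length F) (suc k) ≤ 1 * length (encode (suc k) F)
encode-lower k F =
  ≤-trans (m≤n+m (bound n (suc k)) (suc (suc k + suc (n % modulus k + colourBits n k))))
          (≤-reflexive (sym (trans (*-identityˡ _) (length-encode k F))))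
  where n = length F

-- ... and at most 25 · bound(n, K): the header is O(K · logTerm) bits.
encode-upper : ∀ k F → length (encode (suc k) F) ≤ 25 * bound (length F) (suc k)
encode-upper k F = begin
  length (encode K F)                              ≡⟨ length-encode k F ⟩
  suc (K + suc (n % modulus k + W)) + b            ≤⟨ +-monoˡ-≤ b (s≤s (+-monoʳ-≤ K (s≤s (+-mono-≤ r≤ (s≤s (+-mono-≤ L≤ L≤)))))) ⟩
  suc (K + suc (K + K + suc (M + M))) + b          ≡⟨ arithmetic K T b ⟩
  17 * K + 5 * 1 + 2 * (K * T) + b                 ≤⟨ +-monoˡ-≤ b (+-mono-≤ (+-mono-≤ (*-monoʳ-≤ 17 K≤b) (*-monoʳ-≤ 5 1≤b)) (*-monoʳ-≤ 2 KT≤b)) ⟩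
  17 * b + 5 * b + 2 * b + b                       ≡⟨ collect b ⟩
  25 * b                                           ∎
  where
  open ≤-Reasoning
  K = suc k
  n = length F
  W = colourBits n k
  T = logTerm n K
  b = bound n K
  M = 1 + K * (T + 5) + 2 * K
  r≤ : n % modulus k ≤ K + K
  r≤ = ≤-pred (m%n<n n (modulus k))
  L≤ : scriptWindow n k ≤ M
  L≤ = +-monoˡ-≤ (2 * K) (+-monoʳ-≤ 1 (*-monoʳ-≤ K (+-monoˡ-≤ 5 (width-shift n k))))
  T≤TT : T ≤ T * T
  T≤TT = m≤m*n T T
  KT≤b : K * T ≤ b
  KT≤b = *-monoʳ-≤ K T≤TT
  K≤b : K ≤ b
  K≤b = ≤-trans (m≤m*n K T) KT≤b
  1≤b : 1 ≤ b
  1≤b = ≤-trans (s≤s z≤n) K≤b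
  arithmetic : ∀ K T b → suc (K + suc (K + K + suc ((1 + K * (T + 5) + 2 * K) + (1 + K * (T + 5) + 2 * K)))) + b
                         ≡ 17 * K + 5 * 1 + 2 * (K * T) + b
  arithmetic = solve-∀
  collect : ∀ b → 17 * b + 5 * b + 2 * b + b ≡ 25 * b
  collect = solve-∀

theorem2 : Σ (ℕ → List Bool → List Bool) λ enc →
           Σ (List Bool → List Bool → List Bool) λ dec →
           Σ ℕ λ c₁ → Σ ℕ λ c₂ →
             ((k : ℕ) (F : List Bool) → 0 < k →
                bound (length F) k ≤ c₁ * length (enc k F)
                × length (enc k F) ≤ c₂ * bound (length F) k)
             × ((k : ℕ) (F F′ : List Bool) → 0 < k → EDLe k F F′ →
                dec (enc k F) F′ ≡ F)
theorem2 = encode , decode , 1 , 25 , sizes , correct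
  where
  sizes : (k : ℕ) (F : List Bool) → 0 < k →
          bound (length F) k ≤ 1 * length (encode k F) × length (encode k F) ≤ 25 * bound (length F) k
  sizes (suc k) F _ = encode-lower k F , encode-upper k F
  correct : (k : ℕ) (F F′ : List Bool) → 0 < k → EDLe k F F′ → decode (encode k F) F′ ≡ F
  correct (suc k) F F′ _ ed = decode-encode k (fromEDLe ed)
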